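{- Let $p$ be an odd prime, $N\ge1$ an integer, $\mathcal V=\mathcal V(p,N)$ and $D=2Np(p-1)^{1/2}$. For every $\alpha=\sum_{j=1}^{p-1}a_j\omega^j\in\mathbb{Z}[\omega]$, with $\boldsymbol\alpha=(a_1,\dots,a_{p-1})$, \[ \begin{aligned} M_{p,N}(\alpha,\mathcal V)&:=\frac1{\#\mathcal V}\sum_{x\in\mathcal V}\big(\mathfrak d_{p,N}(\alpha,x)^2-A_{p,N}(\alpha,\mathcal V)\big)^2\\ &=\frac{2N^2}{D^4}\Big((N^2+2\|\boldsymbol\alpha\|_E^2)p^4-(N^2+2\mathrm{Tr}(\alpha)^2)p^3-(3N^2+2\mathrm{Tr}(\alpha)^2)p^2\\ &\qquad\qquad+(N^2-2\mathrm{Tr}(\alpha)^2)p+2(N^2-\mathrm{Tr}(\alpha)^2)\Big), \end{aligned} \] where $A_{p,N}(\alpha,\mathcal V)=\frac1{\#\mathcal V}\sum_{x\in\mathcal V}\mathfrak d_{p,N}(\alpha,x)^2$.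
   Context: $\omega=\exp(2\pi i/p)$; $\mathbb{Z}[\omega]=\{\sum_{j=1}^{p-1}a_j\omega^j:a_j\in\mathbb{Z}\}$; $\mathcal V(p,N)=\{\sum_{j=1}^{p-1}a_j\omega^j: a_j\in\{ -N,N\}\}$. For $\gamma\in\mathbb{Q}(\omega)$, $\mathrm{Tr}(\gamma)=\sum_{\sigma\in\mathrm{Gal}(\mathbb{Q}(\omega)/\mathbb{Q})}\sigma(\gamma)$, $\|\gamma\|=\big(\sum_{j=1}^{p-1}\mathrm{Tr}(\gamma\omega^j)^2\big)^{1/2}$, $\mathfrak d_{p,N}(\alpha,\beta)=\|\beta-\alpha\|/(2Np(p-1)^{1/2})$; $\|\boldsymbol\alpha\|_E$ is the Euclidean norm. -}

module Defs where

open import Data.Nat as ℕ using (ℕ; zero; suc; _∸_; _≡ᵇ_)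
open import Data.Integer as ℤ using (ℤ; +_)
open import Data.Rational as ℚ using (ℚ; 0ℚ)
open import Data.Rational.Properties as ℚP using ()
open import Data.Fin using (Fin; toℕ)
open import Data.Fin.Base as Fin using ()
open import Data.Bool using (Bool; true; false; if_then_else_)
open import Data.List as List using (List; []; _∷_; length)
import Data.Vec.Functional as VF
open import Relation.Nullary using (yes; no)

∑ℤ : (n : ℕ) → (Fin n → ℤ) → ℤ
∑ℤ zero    f = + 0
∑ℤ (suc n) f = f Fin.zero ℤ.+ ∑ℤ n (λ i → f (Fin.suc i))

∑ℤ₁ : (n : ℕ) → (ℕ → ℤ) → ℤ
∑ℤ₁ n f = ∑ℤ n (λ i → f (suc (toℕ i)))

sumℚ : List ℚ → ℚ
sumℚ = List.foldr ℚ._+_ 0ℚ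

-- total division on ℚ (only ever used with nonzero divisor)
_÷'_ : ℚ → ℚ → ℚ
x ÷' y with y ℚP.≟ 0ℚ
... | yes _  = 0ℚ
... | no y≢0 = ℚ._÷_ x y {{ℚ.≢-nonZero y≢0}}

average : List ℚ → ℚ
average xs = sumℚ xs ÷' (+ length xs ℚ./ 1)

ℤ→ℚ : ℤ → ℚ
ℤ→ℚ z = z ℚ./ 1

-- ℤ[ω], ω = exp(2πi/p): an element Σ_{j=1}^{p-1} a_j ω^j is represented by
-- its coordinate vector (a_1,…,a_{p-1}) w.r.t. the ℤ-basis ω,…,ω^{p-1};
-- index i : Fin (p-1) stands for exponent toℕ i + 1.

Zω : ℕ → Set
Zω p = Fin (p ∸ 1) → ℤ

modp : ℕ → ℕ → ℕ
modp a zero    = a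
modp a (suc q) = a ℕ.% suc q

-- Given c = (c_1..c_{p-1}) and an exponent map f, the element
-- Σ_k c_k ω^{f(k)}.  Coefficient of ω^m (0 ≤ m < p) in the group-ring form:
grCoeff : (p : ℕ) → (ℕ → ℕ) → Zω p → ℕ → ℤ
grCoeff p f c m = ∑ℤ (p ∸ 1) (λ i → if modp (f (suc (toℕ i))) p ≡ᵇ m then c i else + 0)

-- Reduction to the basis ω,…,ω^{p-1} using 1 = ω^0 = -(ω + … + ω^{p-1}):
-- coordinate at ω^e is d_e - d_0.
push : (p : ℕ) → (ℕ → ℕ) → Zω p → Zω p
push p f c i = grCoeff p f c (suc (toℕ i)) ℤ.- grCoeff p f c 0

mulω : (p : ℕ) → ℕ → Zω p → Zω p
mulω p j = push p (λ k → k ℕ.+ j)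

-- Galois automorphism σ_a : ω ↦ ω^a  (a = 1,…,p-1 exhaust Gal(ℚ(ω)/ℚ))
σ : (p : ℕ) → ℕ → Zω p → Zω p
σ p a = push p (λ k → a ℕ.* k)

trElem : (p : ℕ) → Zω p → Zω p
trElem p γ i = ∑ℤ₁ (p ∸ 1) (λ a → σ p a γ i)

coord₁ : ∀ {n} → (Fin n → ℤ) → ℤ
coord₁ {zero}  _ = + 0
coord₁ {suc n} v = v Fin.zero

-- Tr(γ) ∈ ℤ.  trElem γ is a rational integer t, whose coordinate vector is
-- (-t,…,-t) since t = -t(ω+…+ω^{p-1}); so t = -(ω^1-coordinate).
Tr : (p : ℕ) → Zω p → ℤ
Tr p γ = ℤ.- coord₁ (trElem p γ)

normSq : (p : ℕ) → Zω p → ℤ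
normSq p γ = ∑ℤ₁ (p ∸ 1) (λ j → Tr p (mulω p j γ) ℤ.* Tr p (mulω p j γ))

subω : (p : ℕ) → Zω p → Zω p → Zω p
subω p β α i = β i ℤ.- α i

euclidSq : (p : ℕ) → Zω p → ℤ
euclidSq p α = ∑ℤ (p ∸ 1) (λ i → α i ℤ.* α i)

allSigns : (n : ℕ) → List (Fin n → Bool)
allSigns zero    = (λ ()) ∷ []
allSigns (suc n) = List.concatMap (λ s → (true VF.∷ s) ∷ (false VF.∷ s) ∷ []) (allSigns n)

𝒱 : (p N : ℕ) → List (Zω p)
𝒱 p N = List.map (λ s i → if s i then + N else ℤ.- (+ N)) (allSigns (p ∸ 1))

-- D² = (2Np(p-1)^{1/2})² = 4N²p²(p-1)
Dsq : (p N : ℕ) → ℚ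
Dsq p N = + (4 ℕ.* N ℕ.* N ℕ.* p ℕ.* p ℕ.* (p ∸ 1)) ℚ./ 1

𝔡sq : (p N : ℕ) → Zω p → Zω p → ℚ
𝔡sq p N α β = ℤ→ℚ (normSq p (subω p β α)) ÷' Dsq p N

A : (p N : ℕ) → Zω p → ℚ
A p N α = average (List.map (𝔡sq p N α) (𝒱 p N))

M : (p N : ℕ) → Zω p → ℚ
M p N α = average (List.map (λ x → (𝔡sq p N α x ℚ.- A p N α) ℚ.* (𝔡sq p N α x ℚ.- A p N α)) (𝒱 p N))

RHS : (p N : ℕ) → Zω p → ℚ
RHS p N α = (ℤ→ℚ (+ (2 ℕ.* N ℕ.* N)) ÷' (Dsq p N ℚ.* Dsq p N)) ℚ.* ℤ→ℚ poly
  where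
  open import Data.Integer using (_+_; _-_; _*_)
  n² = + (N ℕ.* N)
  t² = Tr p α * Tr p α
  e² = euclidSq p α
  P  = + p
  poly = (n² + + 2 * e²) * (P * P * P * P)
       - (n² + + 2 * t²) * (P * P * P)
       - (+ 3 * n² + + 2 * t²) * (P * P)
       + (n² - + 2 * t²) * P
       + + 2 * (n² - t²)

{-# OPTIONS --safe #-}
-- Write γ = x − α for a vertex x = (N ε₁, …, N εₚ₋₁) of 𝒱, ε ∈ {±1}ᵖ⁻¹.
-- Since Tr(ωᵏ) = −1 for p ∤ k, one gets Tr(ωʲ γ) = p γₚ₋ⱼ − Σᵢ γᵢ, and so
-- ‖γ‖² = p² Σᵢ γᵢ² − (p + 1) (Σᵢ γᵢ)².  With γᵢ = N εᵢ − aᵢ this is a quadratic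
-- polynomial in the two Rademacher sums Σᵢ εᵢ aᵢ and Σᵢ εᵢ, and the first two
-- moments of such a polynomial over the sign cube follow by induction on the
-- dimension.  M is the variance of 𝔡², i.e. the mean of its square minus the
-- square of its mean, which turns these moments into the stated formula.
module Submission where

open import Defs
open import Data.Nat using (ℕ; _≤_)
open import Data.Nat.Primality using (Prime)
open import Relation.Binary.PropositionalEquality using (_≡_; _≢_)

module Residues where

  open import Data.Nat
  open import Data.Nat.Properties
  open import Data.Nat.DivMod
  open import Data.Nat.Divisibility using (divides; m%n≡0⇒n∣m; >⇒∤)
  open import Data.Nat.Primality using (euclidsLemma)
  open import Data.Nat.Coprimality using (prime⇒coprime; coprime-Bézout)
  open import Data.Nat.GCD using (module Bézout)
  open import Data.Nat.Tactic.RingSolver using (solve-∀)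
  open import Data.Product using (∃-syntax; _×_; _,_)
  open import Data.Sum using (inj₁; inj₂)
  open import Relation.Binary.PropositionalEquality
  open import Relation.Nullary using (contradiction)

  open ≡-Reasoning

  [m%d]*n%d≡m*n%d : ∀ m n d .{{_ : NonZero d}} → ((m % d) * n) % d ≡ (m * n) % d
  [m%d]*n%d≡m*n%d m n d = begin
    ((m % d) * n) % d             ≡⟨ %-distribˡ-* (m % d) n d ⟩
    ((m % d % d) * (n % d)) % d   ≡⟨ cong (λ x → (x * (n % d)) % d) (m%n%n≡m%n m d) ⟩
    ((m % d) * (n % d)) % d       ≡⟨ %-distribˡ-* m n d ⟨
    (m * n) % d                   ∎

  m*[n%d]%d≡m*n%d : ∀ m n d .{{_ : NonZero d}} → (m * (n % d)) % d ≡ (m * n) % d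
  m*[n%d]%d≡m*n%d m n d = begin
    (m * (n % d)) % d ≡⟨ cong (_% d) (*-comm m (n % d)) ⟩
    ((n % d) * m) % d ≡⟨ [m%d]*n%d≡m*n%d n m d ⟩
    (n * m) % d       ≡⟨ cong (_% d) (*-comm n m) ⟩
    (m * n) % d       ∎

  m%d≡0⇒m≡d : ∀ {m} d .{{_ : NonZero d}} → 0 < m → m < d + d → m % d ≡ 0 → m ≡ d
  m%d≡0⇒m≡d {m} d 0<m m<d+d m%d≡0 with m%n≡0⇒n∣m m d m%d≡0
  ... | divides 0             m≡0     = contradiction m≡0 (>⇒≢ 0<m)
  ... | divides 1             m≡d     = trans m≡d (+-identityʳ d)
  ... | divides (suc (suc q)) m≡q+2*d =
    contradiction (≤-trans (+-monoʳ-≤ d (m≤m+n d (q * d))) (≤-reflexive (sym m≡q+2*d))) (<⇒≱ m<d+d)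

  mod-inverse-unique : ∀ {a a′ k d} .{{_ : NonZero d}} → a < d → a′ < d →
                       (a * k) % d ≡ 1 → (a′ * k) % d ≡ 1 → a ≡ a′
  mod-inverse-unique {a} {a′} {k} {d} a<d a′<d ak≡1 a′k≡1 = begin
    a                         ≡⟨ m<n⇒m%n≡m a<d ⟨
    a % d                     ≡⟨ cong (_% d) (*-identityʳ a) ⟨
    (a * 1) % d               ≡⟨ cong (λ x → (a * x) % d) a′k≡1 ⟨
    (a * ((a′ * k) % d)) % d  ≡⟨ m*[n%d]%d≡m*n%d a (a′ * k) d ⟩
    (a * (a′ * k)) % d        ≡⟨ cong (_% d) (swap a a′ k) ⟩
    (a′ * (a * k)) % d        ≡⟨ m*[n%d]%d≡m*n%d a′ (a * k) d ⟨
    (a′ * ((a * k) % d)) % d  ≡⟨ cong (λ x → (a′ * x) % d) ak≡1 ⟩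
    (a′ * 1) % d              ≡⟨ cong (_% d) (*-identityʳ a′) ⟩
    a′ % d                    ≡⟨ m<n⇒m%n≡m a′<d ⟩
    a′                        ∎
    where
    swap : ∀ a a′ k → a * (a′ * k) ≡ a′ * (a * k)
    swap = solve-∀

  module _ {n} (p-prime : Prime (suc n)) where

    private
      p : ℕ
      p = suc n

      1%p≡1 : 1 % p ≡ 1
      1%p≡1 = m<n⇒m%n≡m (nonTrivial⇒n>1 p)
        where open Prime p-prime

    m*n%p≢0 : ∀ {a k} → 0 < a → a < p → 0 < k → k < p → (a * k) % p ≢ 0
    m*n%p≢0 {a} {k} 0<a a<p 0<k k<p ak%p≡0 with euclidsLemma a k p-prime (m%n≡0⇒n∣m (a * k) p ak%p≡0)
    ... | inj₁ p∣a = >⇒∤ {{>-nonZero 0<a}} a<p p∣a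
    ... | inj₂ p∣k = >⇒∤ {{>-nonZero 0<k}} k<p p∣k

    mod-inverse : ∀ {k} → 0 < k → k < p → ∃[ a ] a < p × (a * k) % p ≡ 1
    mod-inverse {k} 0<k k<p with coprime-Bézout (prime⇒coprime p-prime {{>-nonZero 0<k}} k<p)
    ... | Bézout.-+ x y 1+xp≡yk = y % p , m%n<n y p , (begin
      ((y % p) * k) % p ≡⟨ [m%d]*n%d≡m*n%d y k p ⟩
      (y * k) % p       ≡⟨ cong (_% p) 1+xp≡yk ⟨
      (1 + x * p) % p   ≡⟨ [m+kn]%n≡m%n 1 x p ⟩
      1 % p             ≡⟨ 1%p≡1 ⟩
      1                 ∎)
    ... | Bézout.+- x y 1+yk≡xp = (n * y) % p , m%n<n (n * y) p , (begin
      ((n * y) % p * k) % p     ≡⟨ [m%d]*n%d≡m*n%d (n * y) k p ⟩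
      (n * y * k) % p           ≡⟨ [m+kn]%n≡m%n (n * y * k) 1 p ⟨
      (n * y * k + 1 * p) % p   ≡⟨ cong (_% p) n*y-inverts-k ⟩
      (1 + (n * x) * p) % p     ≡⟨ [m+kn]%n≡m%n 1 (n * x) p ⟩
      1 % p                     ≡⟨ 1%p≡1 ⟩
      1                         ∎)
      where
      -- y k ≡ −1 and n ≡ −1 (mod p)
      n*y-inverts-k : n * y * k + 1 * p ≡ 1 + (n * x) * p
      n*y-inverts-k = begin
        n * y * k + 1 * p   ≡⟨ expand n y k ⟩
        1 + n * (1 + y * k) ≡⟨ cong (λ z → 1 + n * z) 1+yk≡xp ⟩
        1 + n * (x * p)     ≡⟨ cong (1 +_) (*-assoc n x p) ⟨
        1 + (n * x) * p     ∎
        where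
        expand : ∀ n y k → n * y * k + 1 * suc n ≡ 1 + n * (1 + y * k)
        expand = solve-∀

open Residues

open import Data.Nat as ℕ using (zero; suc; _<_; s≤s; z≤n; _^_)
import Data.Nat.Properties as ℕ
open import Data.Nat.DivMod using (_%_; m%n<n; n%n≡0)
open import Data.Nat.Primality using (¬prime[0]; ¬prime[1])
open import Data.Integer as ℤ using (ℤ; +_; _+_; _-_; _*_; -_)
import Data.Integer.Properties as ℤ
open import Data.Integer.Tactic.RingSolver using (solve-∀)
open import Data.Rational as ℚ using (ℚ; 0ℚ; 1ℚ; toℚᵘ)
import Data.Rational.Properties as ℚ
open import Data.Rational.Unnormalised as ℚᵘ using (mkℚᵘ; *≡*)
import Data.Rational.Unnormalised.Properties as ℚᵘ
open import Data.Rational.Solver using (module +-*-Solver)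
open import Data.Fin using (Fin; zero; suc; toℕ; fromℕ<; opposite; punchIn)
open import Data.Fin.Properties using (toℕ-injective; toℕ-fromℕ<; toℕ<n; opposite-prop; punchInᵢ≢i)
import Data.Fin.Permutation as Perm
open import Data.Bool using (Bool; true; false; if_then_else_)
import Data.Vec.Functional as VF
open import Data.List as List using (List; []; _∷_; map; length; concatMap)
import Data.List.Properties as List
open import Data.Product using (∃-syntax; _,_)
open import Function using (_∘_)
open import Relation.Binary.PropositionalEquality
open import Relation.Nullary using (yes; no; contradiction)
open import Relation.Nullary.Decidable using (dec-true; dec-false)
open import Algebra.Properties.Semiring.Sum ℤ.+-*-semiring
  using (sum; sum-cong-≗; ∑-distrib-+; ∑-comm; sum-permute; *-distribˡ-sum; sum-remove; sum-replicate-zero)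

open +-*-Solver using (solve; _:=_; _:+_; _:*_; _:-_; con)

-- Finite sums

∑ℤ≡sum : ∀ n (f : Fin n → ℤ) → ∑ℤ n f ≡ sum f
∑ℤ≡sum zero    f = refl
∑ℤ≡sum (suc n) f = cong (_+_ (f zero)) (∑ℤ≡sum n (f ∘ suc))

∑ℤ-cong : ∀ n {f g : Fin n → ℤ} → f ≗ g → ∑ℤ n f ≡ ∑ℤ n g
∑ℤ-cong n {f} {g} f≗g = begin
  ∑ℤ n f ≡⟨ ∑ℤ≡sum n f ⟩
  sum f  ≡⟨ sum-cong-≗ f≗g ⟩
  sum g  ≡⟨ ∑ℤ≡sum n g ⟨
  ∑ℤ n g ∎
  where open ≡-Reasoning

∑ℤ-distrib-+ : ∀ n (f g : Fin n → ℤ) → ∑ℤ n (λ i → f i + g i) ≡ ∑ℤ n f + ∑ℤ n g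
∑ℤ-distrib-+ n f g = begin
  ∑ℤ n (λ i → f i + g i) ≡⟨ ∑ℤ≡sum n _ ⟩
  sum (λ i → f i + g i)  ≡⟨ ∑-distrib-+ f g ⟩
  sum f + sum g          ≡⟨ cong₂ _+_ (∑ℤ≡sum n f) (∑ℤ≡sum n g) ⟨
  ∑ℤ n f + ∑ℤ n g        ∎
  where open ≡-Reasoning

∑ℤ-distribˡ-* : ∀ n c (f : Fin n → ℤ) → ∑ℤ n (λ i → c * f i) ≡ c * ∑ℤ n f
∑ℤ-distribˡ-* n c f = begin
  ∑ℤ n (λ i → c * f i) ≡⟨ ∑ℤ≡sum n _ ⟩
  sum (λ i → c * f i)  ≡⟨ *-distribˡ-sum c f ⟨
  c * sum f            ≡⟨ cong (c *_) (∑ℤ≡sum n f) ⟨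
  c * ∑ℤ n f           ∎
  where open ≡-Reasoning

∑ℤ-neg : ∀ n (f : Fin n → ℤ) → ∑ℤ n (λ i → - f i) ≡ - ∑ℤ n f
∑ℤ-neg zero    f = refl
∑ℤ-neg (suc n) f = trans (cong (_+_ (- f zero)) (∑ℤ-neg n (f ∘ suc))) (sym (ℤ.neg-distrib-+ (f zero) _))

∑ℤ-distrib-- : ∀ n (f g : Fin n → ℤ) → ∑ℤ n (λ i → f i - g i) ≡ ∑ℤ n f - ∑ℤ n g
∑ℤ-distrib-- n f g = trans (∑ℤ-distrib-+ n f (λ i → - g i)) (cong (_+_ (∑ℤ n f)) (∑ℤ-neg n g))

∑ℤ-const : ∀ n c → ∑ℤ n (λ _ → c) ≡ + n * c
∑ℤ-const zero    c = sym (ℤ.*-zeroˡ c)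
∑ℤ-const (suc n) c = trans (cong (_+_ c) (∑ℤ-const n c)) (sym (ℤ.suc-* (+ n) c))

∑ℤ-zero : ∀ n {f : Fin n → ℤ} → (∀ i → f i ≡ + 0) → ∑ℤ n f ≡ + 0
∑ℤ-zero n f≡0 = trans (∑ℤ-cong n f≡0) (trans (∑ℤ-const n (+ 0)) (ℤ.*-zeroʳ (+ n)))

∑ℤ-comm : ∀ m n (f : Fin m → Fin n → ℤ) →
          ∑ℤ m (λ i → ∑ℤ n (f i)) ≡ ∑ℤ n (λ j → ∑ℤ m (λ i → f i j))
∑ℤ-comm m n f = begin
  ∑ℤ m (λ i → ∑ℤ n (f i))               ≡⟨ ∑ℤ≡sum m _ ⟩
  sum {m} (λ i → ∑ℤ n (f i))            ≡⟨ sum-cong-≗ (λ i → ∑ℤ≡sum n (f i)) ⟩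
  sum {m} (λ i → sum (f i))             ≡⟨ ∑-comm f ⟩
  sum {n} (λ j → sum (λ i → f i j))     ≡⟨ sum-cong-≗ (λ j → ∑ℤ≡sum m (λ i → f i j)) ⟨
  sum {n} (λ j → ∑ℤ m (λ i → f i j))    ≡⟨ ∑ℤ≡sum n _ ⟨
  ∑ℤ n (λ j → ∑ℤ m (λ i → f i j))       ∎
  where open ≡-Reasoning

∑ℤ-opposite : ∀ n (f : Fin n → ℤ) → ∑ℤ n (f ∘ opposite) ≡ ∑ℤ n f
∑ℤ-opposite n f = begin
  ∑ℤ n (f ∘ opposite) ≡⟨ ∑ℤ≡sum n _ ⟩
  sum (f ∘ opposite)  ≡⟨ sum-permute f Perm.reverse ⟨
  sum f               ≡⟨ ∑ℤ≡sum n f ⟨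
  ∑ℤ n f              ∎
  where open ≡-Reasoning

∑ℤ-select : ∀ n (f : Fin n → ℤ) i → (∀ j → j ≢ i → f j ≡ + 0) → ∑ℤ n f ≡ f i
∑ℤ-select (suc n) f i f≡0 = begin
  ∑ℤ (suc n) f                 ≡⟨ ∑ℤ≡sum (suc n) f ⟩
  sum f                        ≡⟨ sum-remove f ⟩
  f i + sum (f ∘ punchIn i)    ≡⟨ cong (_+_ (f i)) (sum-cong-≗ (λ j → f≡0 (punchIn i j) (punchInᵢ≢i i j))) ⟩
  f i + sum {n} (λ _ → + 0)    ≡⟨ cong (_+_ (f i)) (sum-replicate-zero n) ⟩
  f i + + 0                    ≡⟨ ℤ.+-identityʳ (f i) ⟩
  f i                          ∎
  where open ≡-Reasoning

if-≡ᵇ-yes : ∀ {A : Set} {m n} {x y : A} → m ≡ n → (if m ℕ.≡ᵇ n then x else y) ≡ x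
if-≡ᵇ-yes {m = m} {n} {x} {y} m≡n = cong (if_then x else y) (dec-true (m ℕ.≟ n) m≡n)

if-≡ᵇ-no : ∀ {A : Set} {m n} {x y : A} → m ≢ n → (if m ℕ.≡ᵇ n then x else y) ≡ y
if-≡ᵇ-no {m = m} {n} {x} {y} m≢n = cong (if_then x else y) (dec-false (m ℕ.≟ n) m≢n)

∑ℤ-if-≡ᵇ-unique : ∀ n (u v : Fin n → ℕ) (f : Fin n → ℤ) i → u i ≡ v i → (∀ j → u j ≡ v j → j ≡ i) →
                  ∑ℤ n (λ j → if u j ℕ.≡ᵇ v j then f j else + 0) ≡ f i
∑ℤ-if-≡ᵇ-unique n u v f i uᵢ≡vᵢ unique =
  trans (∑ℤ-select n _ i (λ j j≢i → if-≡ᵇ-no (j≢i ∘ unique j))) (if-≡ᵇ-yes uᵢ≡vᵢ)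

∑ℤ-if-≡ᵇ-none : ∀ n (u v : Fin n → ℕ) (f : Fin n → ℤ) → (∀ j → u j ≢ v j) →
                ∑ℤ n (λ j → if u j ℕ.≡ᵇ v j then f j else + 0) ≡ + 0
∑ℤ-if-≡ᵇ-none n u v f u≢v = ∑ℤ-zero n (λ j → if-≡ᵇ-no (u≢v j))

∑ℤ-affine² : ∀ n a b (x : Fin n → ℤ) →
  ∑ℤ n (λ i → (a * x i - b) * (a * x i - b)) ≡ a * a * ∑ℤ n (λ i → x i * x i) - + 2 * a * b * ∑ℤ n x + + n * (b * b)
∑ℤ-affine² n a b x = begin
  ∑ℤ n (λ i → (a * x i - b) * (a * x i - b))
    ≡⟨ ∑ℤ-cong n (λ i → expand a b (x i)) ⟩
  ∑ℤ n (λ i → a * a * (x i * x i) + (- (+ 2 * a * b) * x i + b * b))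
    ≡⟨ ∑ℤ-distrib-+ n _ _ ⟩
  ∑ℤ n (λ i → a * a * (x i * x i)) + ∑ℤ n (λ i → - (+ 2 * a * b) * x i + b * b)
    ≡⟨ cong₂ _+_ (∑ℤ-distribˡ-* n (a * a) _) (∑ℤ-distrib-+ n _ _) ⟩
  a * a * Σx² + (∑ℤ n (λ i → - (+ 2 * a * b) * x i) + ∑ℤ n (λ _ → b * b))
    ≡⟨ cong₂ (λ y z → a * a * Σx² + (y + z)) (∑ℤ-distribˡ-* n (- (+ 2 * a * b)) x) (∑ℤ-const n (b * b)) ⟩
  a * a * Σx² + (- (+ 2 * a * b) * ∑ℤ n x + + n * (b * b))
    ≡⟨ regroup (a * a * Σx²) (+ 2 * a * b) (∑ℤ n x) (+ n * (b * b)) ⟩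
  a * a * Σx² - + 2 * a * b * ∑ℤ n x + + n * (b * b) ∎
  where
  open ≡-Reasoning
  Σx² = ∑ℤ n (λ i → x i * x i)
  expand : ∀ a b y → (a * y - b) * (a * y - b) ≡ a * a * (y * y) + (- (+ 2 * a * b) * y + b * b)
  expand = solve-∀
  regroup : ∀ q c s r → q + (- c * s + r) ≡ q - c * s + r
  regroup = solve-∀

-- Trace and norm in ℤ[ω]

exponent-injective : ∀ {n} {i j : Fin n} → suc (toℕ i) ≡ suc (toℕ j) → i ≡ j
exponent-injective = toℕ-injective ∘ ℕ.suc-injective

exponent-surjective : ∀ {n a} → 0 < a → a < suc n → ∃[ i ] suc (toℕ {n} i) ≡ a
exponent-surjective {a = suc a} _ (s≤s a<n) = fromℕ< a<n , cong suc (toℕ-fromℕ< a<n)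

exponent<p : ∀ {n} (i : Fin n) → suc (toℕ i) < suc n
exponent<p i = s≤s (toℕ<n i)

module _ {n} (p-prime : Prime (suc n)) where

  private
    p : ℕ
    p = suc n
    e : Fin n → ℕ
    e i = suc (toℕ i)

  galois-sum-at-0 : (γ : Zω p) → ∑ℤ n (λ a → grCoeff p (e a ℕ.*_) γ 0) ≡ + 0
  galois-sum-at-0 γ = ∑ℤ-zero n λ a →
    ∑ℤ-if-≡ᵇ-none n _ _ γ (λ k → m*n%p≢0 p-prime (s≤s z≤n) (exponent<p a) (s≤s z≤n) (exponent<p k))

  galois-sum-at-1 : (γ : Zω p) → ∑ℤ n (λ a → grCoeff p (e a ℕ.*_) γ 1) ≡ ∑ℤ n γ
  galois-sum-at-1 γ = begin
    ∑ℤ n (λ a → ∑ℤ n (λ k → if (e a ℕ.* e k) % p ℕ.≡ᵇ 1 then γ k else + 0))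
      ≡⟨ ∑ℤ-comm n n _ ⟩
    ∑ℤ n (λ k → ∑ℤ n (λ a → if (e a ℕ.* e k) % p ℕ.≡ᵇ 1 then γ k else + 0))
      ≡⟨ ∑ℤ-cong n select-inverse ⟩
    ∑ℤ n γ ∎
    where
    open ≡-Reasoning
    select-inverse : ∀ k → ∑ℤ n (λ a → if (e a ℕ.* e k) % p ℕ.≡ᵇ 1 then γ k else + 0) ≡ γ k
    select-inverse k with mod-inverse p-prime (s≤s z≤n) (exponent<p k)
    ... | zero , _ , ()
    ... | a@(suc _) , a<p , ak≡1 with exponent-surjective {n} (s≤s z≤n) a<p
    ... | i , refl = ∑ℤ-if-≡ᵇ-unique n (λ a → (e a ℕ.* e k) % p) (λ _ → 1) (λ _ → γ k) i ak≡1
          (λ j ajk≡1 → exponent-injective (mod-inverse-unique {k = e k} (exponent<p j) a<p ajk≡1 ak≡1))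

Tr≡-∑ℤ : ∀ {n} → Prime (suc n) → (γ : Zω (suc n)) → Tr (suc n) γ ≡ - ∑ℤ n γ
Tr≡-∑ℤ {zero}  p-prime γ = contradiction p-prime ¬prime[1]
Tr≡-∑ℤ {suc n} p-prime γ = cong -_ (begin
  ∑ℤ (suc n) (λ a → G a 1 - G a 0)                    ≡⟨ ∑ℤ-distrib-- (suc n) (λ a → G a 1) (λ a → G a 0) ⟩
  ∑ℤ (suc n) (λ a → G a 1) - ∑ℤ (suc n) (λ a → G a 0) ≡⟨ cong₂ _-_ (galois-sum-at-1 p-prime γ) (galois-sum-at-0 p-prime γ) ⟩
  ∑ℤ (suc n) γ - + 0                                  ≡⟨ ℤ.+-identityʳ _ ⟩
  ∑ℤ (suc n) γ                                        ∎)
  where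
  open ≡-Reasoning
  G : Fin (suc n) → ℕ → ℤ
  G a = grCoeff (suc (suc n)) (suc (toℕ a) ℕ.*_) γ

∑-grCoeff : ∀ n f (c : Zω (suc n)) → ∑ℤ (suc n) (λ r → grCoeff (suc n) f c (toℕ r)) ≡ ∑ℤ n c
∑-grCoeff n f c = begin
  ∑ℤ (suc n) (λ r → ∑ℤ n (λ k → if residue k ℕ.≡ᵇ toℕ r then c k else + 0))
    ≡⟨ ∑ℤ-comm (suc n) n (λ r k → if residue k ℕ.≡ᵇ toℕ r then c k else + 0) ⟩
  ∑ℤ n (λ k → ∑ℤ (suc n) (λ r → if residue k ℕ.≡ᵇ toℕ r then c k else + 0))
    ≡⟨ ∑ℤ-cong n (λ k → ∑ℤ-if-≡ᵇ-unique (suc n) (λ _ → residue k) toℕ (λ _ → c k) (bucket k)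
         (sym (toℕ-fromℕ< _)) (λ r k≡r → toℕ-injective (trans (sym k≡r) (sym (toℕ-fromℕ< _))))) ⟩
  ∑ℤ n c ∎
  where
  open ≡-Reasoning
  residue : Fin n → ℕ
  residue k = f (suc (toℕ k)) % suc n
  bucket : Fin n → Fin (suc n)
  bucket k = fromℕ< (m%n<n (f (suc (toℕ k))) (suc n))

Tr-push : ∀ {n} → Prime (suc n) → ∀ f (c : Zω (suc n)) →
          Tr (suc n) (push (suc n) f c) ≡ + suc n * grCoeff (suc n) f c 0 - ∑ℤ n c
Tr-push {n} p-prime f c = begin
  Tr (suc n) (push (suc n) f c)                ≡⟨ Tr≡-∑ℤ p-prime (push (suc n) f c) ⟩
  - ∑ℤ n (λ i → g (suc (toℕ i)) - g 0)         ≡⟨ cong -_ (∑ℤ-distrib-- n _ _) ⟩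
  - (∑ℤ n (g ∘ suc ∘ toℕ) - ∑ℤ n (λ _ → g 0))  ≡⟨ cong (λ x → - (∑ℤ n (g ∘ suc ∘ toℕ) - x)) (∑ℤ-const n (g 0)) ⟩
  - (∑ℤ n (g ∘ suc ∘ toℕ) - + n * g 0)         ≡⟨ regroup (g 0) (∑ℤ n (g ∘ suc ∘ toℕ)) (+ n) ⟩
  + suc n * g 0 - (g 0 + ∑ℤ n (g ∘ suc ∘ toℕ)) ≡⟨ cong (λ x → + suc n * g 0 - x) (∑-grCoeff n f c) ⟩
  + suc n * g 0 - ∑ℤ n c                       ∎
  where
  open ≡-Reasoning
  g : ℕ → ℤ
  g = grCoeff (suc n) f c
  regroup : ∀ g₀ s m → - (s - m * g₀) ≡ (+ 1 + m) * g₀ - (g₀ + s)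
  regroup = solve-∀

-- Index i stands for the exponent i + 1, so the exponent p − (j + 1) belongs to index opposite j.
opposite-exponent : ∀ {n} (j : Fin n) → suc (toℕ (opposite j)) ℕ.+ suc (toℕ j) ≡ suc n
opposite-exponent {n} j = cong suc (begin
  toℕ (opposite j) ℕ.+ suc (toℕ j)   ≡⟨ cong (ℕ._+ suc (toℕ j)) (opposite-prop j) ⟩
  n ℕ.∸ suc (toℕ j) ℕ.+ suc (toℕ j)  ≡⟨ ℕ.m∸n+n≡m (toℕ<n j) ⟩
  n                                  ∎)
  where open ≡-Reasoning

grCoeff-shift-0 : ∀ {n} (j : Fin n) (γ : Zω (suc n)) →
                  grCoeff (suc n) (ℕ._+ suc (toℕ j)) γ 0 ≡ γ (opposite j)
grCoeff-shift-0 {n} j γ = ∑ℤ-if-≡ᵇ-unique n (λ k → (e k ℕ.+ e j) % suc n) (λ _ → 0) γ (opposite j)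
  (trans (cong (_% suc n) (opposite-exponent j)) (n%n≡0 (suc n)))
  (λ k ek+ej%p≡0 → exponent-injective (ℕ.+-cancelʳ-≡ (e j) _ _
     (trans (m%d≡0⇒m≡d (suc n) (s≤s z≤n) (ℕ.+-mono-< (exponent<p k) (exponent<p j)) ek+ej%p≡0)
            (sym (opposite-exponent j)))))
  where
  e : Fin n → ℕ
  e i = suc (toℕ i)

normSq≡ : ∀ {n} → Prime (suc n) → (γ : Zω (suc n)) →
          normSq (suc n) γ ≡ + suc n * + suc n * ∑ℤ n (λ i → γ i * γ i) - (+ suc n + + 1) * (∑ℤ n γ * ∑ℤ n γ)
normSq≡ {n} p-prime γ = begin
  ∑ℤ n (λ j → Tr p (mulω p (suc (toℕ j)) γ) * Tr p (mulω p (suc (toℕ j)) γ))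
    ≡⟨ ∑ℤ-cong n (λ j → cong (λ t → t * t) (Tr-mulω j)) ⟩
  ∑ℤ n (λ j → (+ p * γ (opposite j) - S) * (+ p * γ (opposite j) - S))
    ≡⟨ ∑ℤ-affine² n (+ p) S (γ ∘ opposite) ⟩
  + p * + p * ∑ℤ n (λ j → γ (opposite j) * γ (opposite j)) - + 2 * + p * S * ∑ℤ n (γ ∘ opposite) + + n * (S * S)
    ≡⟨ cong₂ (λ x y → + p * + p * x - + 2 * + p * S * y + + n * (S * S))
             (∑ℤ-opposite n (λ i → γ i * γ i)) (∑ℤ-opposite n γ) ⟩
  + p * + p * E - + 2 * + p * S * S + + n * (S * S)
    ≡⟨ collect E S (+ n) ⟩
  + p * + p * E - (+ p + + 1) * (S * S) ∎
  where
  open ≡-Reasoning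
  p : ℕ
  p = suc n
  S E : ℤ
  S = ∑ℤ n γ
  E = ∑ℤ n (λ i → γ i * γ i)
  Tr-mulω : ∀ j → Tr p (mulω p (suc (toℕ j)) γ) ≡ + p * γ (opposite j) - S
  Tr-mulω j = trans (Tr-push p-prime (ℕ._+ suc (toℕ j)) γ) (cong (λ x → + p * x - S) (grCoeff-shift-0 j γ))
  collect : ∀ E S m → (+ 1 + m) * (+ 1 + m) * E - + 2 * (+ 1 + m) * S * S + m * (S * S)
                      ≡ (+ 1 + m) * (+ 1 + m) * E - ((+ 1 + m) + + 1) * (S * S)
  collect = solve-∀

-- Sums over the sign cube

∑± : ∀ n → ((Fin n → Bool) → ℤ) → ℤ
∑± zero    g = g (λ ())
∑± (suc n) g = ∑± n (λ s → g (true VF.∷ s) + g (false VF.∷ s))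

∑±-cong : ∀ n {g h : (Fin n → Bool) → ℤ} → (∀ s → g s ≡ h s) → ∑± n g ≡ ∑± n h
∑±-cong zero    g≗h = g≗h (λ ())
∑±-cong (suc n) g≗h = ∑±-cong n (λ s → cong₂ _+_ (g≗h (true VF.∷ s)) (g≗h (false VF.∷ s)))

∑±-distrib-+ : ∀ n (g h : (Fin n → Bool) → ℤ) → ∑± n (λ s → g s + h s) ≡ ∑± n g + ∑± n h
∑±-distrib-+ zero    g h = refl
∑±-distrib-+ (suc n) g h = begin
  ∑± n (λ s → (g (true VF.∷ s) + h (true VF.∷ s)) + (g (false VF.∷ s) + h (false VF.∷ s)))
    ≡⟨ ∑±-cong n (λ s → interchange (g (true VF.∷ s)) (h (true VF.∷ s)) (g (false VF.∷ s)) (h (false VF.∷ s))) ⟩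
  ∑± n (λ s → (g (true VF.∷ s) + g (false VF.∷ s)) + (h (true VF.∷ s) + h (false VF.∷ s)))
    ≡⟨ ∑±-distrib-+ n _ _ ⟩
  ∑± (suc n) g + ∑± (suc n) h ∎
  where
  open ≡-Reasoning
  interchange : ∀ a b c d → (a + b) + (c + d) ≡ (a + c) + (b + d)
  interchange = solve-∀

sign : Bool → ℤ
sign true  = + 1
sign false = - + 1

rademacher : ∀ {n} → (Fin n → ℤ) → (Fin n → Bool) → ℤ
rademacher {n} a s = ∑ℤ n (λ i → sign (s i) * a i)

signSum : ∀ {n} → (Fin n → Bool) → ℤ
signSum = rademacher (λ _ → + 1)

quadratic : ∀ {n} (B C G A₀ : ℤ) (a : Fin n → ℤ) → (Fin n → Bool) → ℤ
quadratic B C G A₀ a s = B * rademacher a s + C * signSum s + G * (signSum s * signSum s) + A₀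

-- Fixing the first sign gives a quadratic of the same shape in one dimension less,
-- which is what makes the moments below computable by induction on n.
module _ {n} (B C G A₀ : ℤ) (a : Fin (suc n) → ℤ) (s : Fin n → Bool) where

  quadratic-true∷ : quadratic B C G A₀ a (true VF.∷ s)
                    ≡ quadratic B (C + + 2 * G) G (A₀ + B * a zero + C + G) (a ∘ suc) s
  quadratic-true∷ = shift B C G A₀ (a zero) (rademacher (a ∘ suc) s) (signSum s)
    where
    shift : ∀ B C G A₀ a₀ L σ →
      B * (+ 1 * a₀ + L) + C * (+ 1 * + 1 + σ) + G * ((+ 1 * + 1 + σ) * (+ 1 * + 1 + σ)) + A₀
      ≡ B * L + (C + + 2 * G) * σ + G * (σ * σ) + (A₀ + B * a₀ + C + G)
    shift = solve-∀

  quadratic-false∷ : quadratic B C G A₀ a (false VF.∷ s)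
                     ≡ quadratic B (C - + 2 * G) G (A₀ - B * a zero - C + G) (a ∘ suc) s
  quadratic-false∷ = shift B C G A₀ (a zero) (rademacher (a ∘ suc) s) (signSum s)
    where
    shift : ∀ B C G A₀ a₀ L σ →
      B * (- + 1 * a₀ + L) + C * (- + 1 * + 1 + σ) + G * ((- + 1 * + 1 + σ) * (- + 1 * + 1 + σ)) + A₀
      ≡ B * L + (C - + 2 * G) * σ + G * (σ * σ) + (A₀ - B * a₀ - C + G)
    shift = solve-∀

2^suc : ∀ n → + (2 ^ suc n) ≡ + 2 * + (2 ^ n)
2^suc n = ℤ.pos-* 2 (2 ^ n)

∑±-quadratic : ∀ n B C G A₀ (a : Fin n → ℤ) →
               ∑± n (quadratic B C G A₀ a) ≡ + (2 ^ n) * (A₀ + G * + n)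
∑±-quadratic zero    B C G A₀ a = base B C G A₀
  where
  base : ∀ B C G A₀ → B * + 0 + C * + 0 + G * (+ 0 * + 0) + A₀ ≡ + 1 * (A₀ + G * + 0)
  base = solve-∀
∑±-quadratic (suc n) B C G A₀ a = begin
  ∑± n (λ s → quadratic B C G A₀ a (true VF.∷ s) + quadratic B C G A₀ a (false VF.∷ s))
    ≡⟨ ∑±-cong n (λ s → cong₂ _+_ (quadratic-true∷ B C G A₀ a s) (quadratic-false∷ B C G A₀ a s)) ⟩
  ∑± n (λ s → quadratic B C⁺ G A₀⁺ a′ s + quadratic B C⁻ G A₀⁻ a′ s)
    ≡⟨ ∑±-distrib-+ n (quadratic B C⁺ G A₀⁺ a′) (quadratic B C⁻ G A₀⁻ a′) ⟩
  ∑± n (quadratic B C⁺ G A₀⁺ a′) + ∑± n (quadratic B C⁻ G A₀⁻ a′)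
    ≡⟨ cong₂ _+_ (∑±-quadratic n B C⁺ G A₀⁺ a′) (∑±-quadratic n B C⁻ G A₀⁻ a′) ⟩
  + (2 ^ n) * (A₀⁺ + G * + n) + + (2 ^ n) * (A₀⁻ + G * + n)
    ≡⟨ step (+ (2 ^ n)) (+ n) B C G A₀ (a zero) ⟩
  + 2 * + (2 ^ n) * (A₀ + G * + suc n)
    ≡⟨ cong (λ k → k * (A₀ + G * + suc n)) (2^suc n) ⟨
  + (2 ^ suc n) * (A₀ + G * + suc n) ∎
  where
  open ≡-Reasoning
  a′ = a ∘ suc
  C⁺ = C + + 2 * G
  C⁻ = C - + 2 * G
  A₀⁺ = A₀ + B * a zero + C + G
  A₀⁻ = A₀ - B * a zero - C + G
  step : ∀ K m B C G A₀ a₀ →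
    K * (A₀ + B * a₀ + C + G + G * m) + K * (A₀ - B * a₀ - C + G + G * m) ≡ + 2 * K * (A₀ + G * (+ 1 + m))
  step = solve-∀

∑±-quadratic² : ∀ n B C G A₀ (a : Fin n → ℤ) →
  ∑± n (λ s → quadratic B C G A₀ a s * quadratic B C G A₀ a s)
  ≡ + (2 ^ n) * (B * B * ∑ℤ n (λ i → a i * a i) + + 2 * B * C * ∑ℤ n a + C * C * + n
                 + G * G * (+ 3 * + n * + n - + 2 * + n) + + 2 * A₀ * G * + n + A₀ * A₀)
∑±-quadratic² zero    B C G A₀ a = base B C G A₀
  where
  base : ∀ B C G A₀ → (B * + 0 + C * + 0 + G * (+ 0 * + 0) + A₀) * (B * + 0 + C * + 0 + G * (+ 0 * + 0) + A₀)
         ≡ + 1 * (B * B * + 0 + + 2 * B * C * + 0 + C * C * + 0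
                  + G * G * (+ 3 * + 0 * + 0 - + 2 * + 0) + + 2 * A₀ * G * + 0 + A₀ * A₀)
  base = solve-∀
∑±-quadratic² (suc n) B C G A₀ a = begin
  ∑± n (λ s → sq (quadratic B C G A₀ a (true VF.∷ s)) + sq (quadratic B C G A₀ a (false VF.∷ s)))
    ≡⟨ ∑±-cong n (λ s → cong₂ _+_ (cong sq (quadratic-true∷ B C G A₀ a s)) (cong sq (quadratic-false∷ B C G A₀ a s))) ⟩
  ∑± n (λ s → sq (quadratic B C⁺ G A₀⁺ a′ s) + sq (quadratic B C⁻ G A₀⁻ a′ s))
    ≡⟨ ∑±-distrib-+ n (sq ∘ quadratic B C⁺ G A₀⁺ a′) (sq ∘ quadratic B C⁻ G A₀⁻ a′) ⟩
  ∑± n (sq ∘ quadratic B C⁺ G A₀⁺ a′) + ∑± n (sq ∘ quadratic B C⁻ G A₀⁻ a′)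
    ≡⟨ cong₂ _+_ (∑±-quadratic² n B C⁺ G A₀⁺ a′) (∑±-quadratic² n B C⁻ G A₀⁻ a′) ⟩
  + (2 ^ n) * Q (+ n) E′ T′ C⁺ A₀⁺ + + (2 ^ n) * Q (+ n) E′ T′ C⁻ A₀⁻
    ≡⟨ step (+ (2 ^ n)) (+ n) B C G A₀ (a zero) E′ T′ ⟩
  + 2 * + (2 ^ n) * Q (+ suc n) (a zero * a zero + E′) (a zero + T′) C A₀
    ≡⟨ cong (λ k → k * Q (+ suc n) (a zero * a zero + E′) (a zero + T′) C A₀) (2^suc n) ⟨
  + (2 ^ suc n) * Q (+ suc n) (a zero * a zero + E′) (a zero + T′) C A₀ ∎
  where
  open ≡-Reasoning
  sq : ℤ → ℤ
  sq x = x * x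
  a′ = a ∘ suc
  E′ = ∑ℤ n (λ i → a′ i * a′ i)
  T′ = ∑ℤ n a′
  C⁺ = C + + 2 * G
  C⁻ = C - + 2 * G
  A₀⁺ = A₀ + B * a zero + C + G
  A₀⁻ = A₀ - B * a zero - C + G
  Q : ℤ → ℤ → ℤ → ℤ → ℤ → ℤ
  Q m E T C A₀ = B * B * E + + 2 * B * C * T + C * C * m + G * G * (+ 3 * m * m - + 2 * m) + + 2 * A₀ * G * m + A₀ * A₀
  step : ∀ K m B C G A₀ a₀ E T →
    K * (B * B * E + + 2 * B * (C + + 2 * G) * T + (C + + 2 * G) * (C + + 2 * G) * m
         + G * G * (+ 3 * m * m - + 2 * m) + + 2 * (A₀ + B * a₀ + C + G) * G * m
         + (A₀ + B * a₀ + C + G) * (A₀ + B * a₀ + C + G))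
    + K * (B * B * E + + 2 * B * (C - + 2 * G) * T + (C - + 2 * G) * (C - + 2 * G) * m
         + G * G * (+ 3 * m * m - + 2 * m) + + 2 * (A₀ - B * a₀ - C + G) * G * m
         + (A₀ - B * a₀ - C + G) * (A₀ - B * a₀ - C + G))
    ≡ + 2 * K * (B * B * (a₀ * a₀ + E) + + 2 * B * C * (a₀ + T) + C * C * (+ 1 + m)
                 + G * G * (+ 3 * (+ 1 + m) * (+ 1 + m) - + 2 * (+ 1 + m))
                 + + 2 * A₀ * G * (+ 1 + m) + A₀ * A₀)
  step = solve-∀

∑±-quadratic-spread : ∀ n B C G A₀ (a : Fin n → ℤ) →
  + (2 ^ n) * ∑± n (λ s → quadratic B C G A₀ a s * quadratic B C G A₀ a s)
  ≡ ∑± n (quadratic B C G A₀ a) * ∑± n (quadratic B C G A₀ a)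
    + + (2 ^ n) * + (2 ^ n) * (B * B * ∑ℤ n (λ i → a i * a i) + + 2 * B * C * ∑ℤ n a + C * C * + n
                               + + 2 * G * G * (+ n * + n - + n))
∑±-quadratic-spread n B C G A₀ a = begin
  K * ∑± n (λ s → quadratic B C G A₀ a s * quadratic B C G A₀ a s)
    ≡⟨ cong (K *_) (∑±-quadratic² n B C G A₀ a) ⟩
  K * (K * (B * B * E + + 2 * B * C * T + C * C * m + G * G * (+ 3 * m * m - + 2 * m) + + 2 * A₀ * G * m + A₀ * A₀))
    ≡⟨ complete-square K m B C G A₀ E T ⟩
  K * (A₀ + G * m) * (K * (A₀ + G * m)) + K * K * (B * B * E + + 2 * B * C * T + C * C * m + + 2 * G * G * (m * m - m))
    ≡⟨ cong (λ x → x * x + K * K * (B * B * E + + 2 * B * C * T + C * C * m + + 2 * G * G * (m * m - m)))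
            (∑±-quadratic n B C G A₀ a) ⟨
  ∑± n (quadratic B C G A₀ a) * ∑± n (quadratic B C G A₀ a)
    + K * K * (B * B * E + + 2 * B * C * T + C * C * m + + 2 * G * G * (m * m - m)) ∎
  where
  open ≡-Reasoning
  K = + (2 ^ n)
  m = + n
  E = ∑ℤ n (λ i → a i * a i)
  T = ∑ℤ n a
  complete-square : ∀ K m B C G A₀ E T →
    K * (K * (B * B * E + + 2 * B * C * T + C * C * m + G * G * (+ 3 * m * m - + 2 * m) + + 2 * A₀ * G * m + A₀ * A₀))
    ≡ K * (A₀ + G * m) * (K * (A₀ + G * m)) + K * K * (B * B * E + + 2 * B * C * T + C * C * m + + 2 * G * G * (m * m - m))
  complete-square = solve-∀

-- Rationals and the variance identity

toℚᵘ-ℤ→ℚ : ∀ z → toℚᵘ (ℤ→ℚ z) ℚᵘ.≃ mkℚᵘ z 0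
toℚᵘ-ℤ→ℚ z = ℚ.toℚᵘ-fromℚᵘ (mkℚᵘ z 0)

ℤ→ℚ-+ : ∀ a b → ℤ→ℚ (a + b) ≡ ℤ→ℚ a ℚ.+ ℤ→ℚ b
ℤ→ℚ-+ a b = ℚ.toℚᵘ-injective (begin
  toℚᵘ (ℤ→ℚ (a + b))                 ≈⟨ toℚᵘ-ℤ→ℚ (a + b) ⟩
  mkℚᵘ (a + b) 0                      ≈⟨ *≡* (denominators a b) ⟩
  mkℚᵘ a 0 ℚᵘ.+ mkℚᵘ b 0              ≈⟨ ℚᵘ.+-cong (toℚᵘ-ℤ→ℚ a) (toℚᵘ-ℤ→ℚ b) ⟨
  toℚᵘ (ℤ→ℚ a) ℚᵘ.+ toℚᵘ (ℤ→ℚ b)     ≈⟨ ℚ.toℚᵘ-homo-+ (ℤ→ℚ a) (ℤ→ℚ b) ⟨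
  toℚᵘ (ℤ→ℚ a ℚ.+ ℤ→ℚ b)             ∎)
  where
  open ℚᵘ.≃-Reasoning
  denominators : ∀ a b → (a + b) * + 1 ≡ (a * + 1 + b * + 1) * + 1
  denominators = solve-∀

ℤ→ℚ-* : ∀ a b → ℤ→ℚ (a * b) ≡ ℤ→ℚ a ℚ.* ℤ→ℚ b
ℤ→ℚ-* a b = ℚ.toℚᵘ-injective (begin
  toℚᵘ (ℤ→ℚ (a * b))                 ≈⟨ toℚᵘ-ℤ→ℚ (a * b) ⟩
  mkℚᵘ (a * b) 0                      ≈⟨ ℚᵘ.*-cong (toℚᵘ-ℤ→ℚ a) (toℚᵘ-ℤ→ℚ b) ⟨
  toℚᵘ (ℤ→ℚ a) ℚᵘ.* toℚᵘ (ℤ→ℚ b)     ≈⟨ ℚ.toℚᵘ-homo-* (ℤ→ℚ a) (ℤ→ℚ b) ⟨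
  toℚᵘ (ℤ→ℚ a ℚ.* ℤ→ℚ b)             ∎)
  where open ℚᵘ.≃-Reasoning

ℤ→ℚ-injective : ∀ {a b} → ℤ→ℚ a ≡ ℤ→ℚ b → a ≡ b
ℤ→ℚ-injective {a} {b} eq
  with ℚᵘ.≃-trans (ℚᵘ.≃-sym (toℚᵘ-ℤ→ℚ a)) (ℚᵘ.≃-trans (ℚᵘ.≃-reflexive (cong toℚᵘ eq)) (toℚᵘ-ℤ→ℚ b))
... | *≡* a*1≡b*1 = trans (sym (ℤ.*-identityʳ a)) (trans a*1≡b*1 (ℤ.*-identityʳ b))

ℤ→ℚ-≢0 : ∀ {z} → z ≢ + 0 → ℤ→ℚ z ≢ 0ℚ
ℤ→ℚ-≢0 z≢0 z≡0 = z≢0 (ℤ→ℚ-injective z≡0)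

÷'-by-inverse : ∀ c {x y} → x ℚ.* y ≡ 1ℚ → c ÷' y ≡ c ℚ.* x
÷'-by-inverse c {x} {y} x*y≡1 with y ℚ.≟ 0ℚ
... | yes y≡0 = contradiction (trans (sym x*y≡1) (trans (cong (x ℚ.*_) y≡0) (ℚ.*-zeroʳ x))) ℚ.1≢0
... | no  y≢0 = begin
  c ℚ.* 1/y                        ≡⟨ cong (c ℚ.*_) (ℚ.*-identityˡ 1/y) ⟨
  c ℚ.* (1ℚ ℚ.* 1/y)               ≡⟨ cong (λ z → c ℚ.* (z ℚ.* 1/y)) x*y≡1 ⟨
  c ℚ.* (x ℚ.* y ℚ.* 1/y)          ≡⟨ cong (c ℚ.*_) (ℚ.*-assoc x y 1/y) ⟩
  c ℚ.* (x ℚ.* (y ℚ.* 1/y))        ≡⟨ cong (λ z → c ℚ.* (x ℚ.* z)) (ℚ.*-inverseʳ y {{ℚ.≢-nonZero y≢0}}) ⟩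
  c ℚ.* (x ℚ.* 1ℚ)                 ≡⟨ cong (c ℚ.*_) (ℚ.*-identityʳ x) ⟩
  c ℚ.* x                          ∎
  where
  open ≡-Reasoning
  1/y = (ℚ.1/ y) {{ℚ.≢-nonZero y≢0}}

sumℚ-sq-sub : ∀ (ys : List ℚ) a →
  sumℚ (map (λ y → (y ℚ.- a) ℚ.* (y ℚ.- a)) ys)
  ≡ sumℚ (map (λ y → y ℚ.* y) ys) ℚ.- (a ℚ.* sumℚ ys ℚ.+ a ℚ.* sumℚ ys) ℚ.+ ℤ→ℚ (+ length ys) ℚ.* (a ℚ.* a)
sumℚ-sq-sub []       a = solve 1 (λ a → con 0ℚ := con 0ℚ :- (a :* con 0ℚ :+ a :* con 0ℚ) :+ con 0ℚ :* (a :* a)) refl a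
sumℚ-sq-sub (y ∷ ys) a = begin
  (y ℚ.- a) ℚ.* (y ℚ.- a) ℚ.+ sumℚ (map (λ y → (y ℚ.- a) ℚ.* (y ℚ.- a)) ys)
    ≡⟨ cong (ℚ._+_ ((y ℚ.- a) ℚ.* (y ℚ.- a))) (sumℚ-sq-sub ys a) ⟩
  (y ℚ.- a) ℚ.* (y ℚ.- a) ℚ.+ (Q ℚ.- (a ℚ.* S ℚ.+ a ℚ.* S) ℚ.+ m ℚ.* (a ℚ.* a))
    ≡⟨ solve 5 (λ y a Q S m → (y :- a) :* (y :- a) :+ (Q :- (a :* S :+ a :* S) :+ m :* (a :* a))
                           := (y :* y :+ Q) :- (a :* (y :+ S) :+ a :* (y :+ S)) :+ (con 1ℚ :+ m) :* (a :* a))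
             refl y a Q S m ⟩
  (y ℚ.* y ℚ.+ Q) ℚ.- (a ℚ.* (y ℚ.+ S) ℚ.+ a ℚ.* (y ℚ.+ S)) ℚ.+ (1ℚ ℚ.+ m) ℚ.* (a ℚ.* a)
    ≡⟨ cong (λ k → (y ℚ.* y ℚ.+ Q) ℚ.- (a ℚ.* (y ℚ.+ S) ℚ.+ a ℚ.* (y ℚ.+ S)) ℚ.+ k ℚ.* (a ℚ.* a))
            (ℤ→ℚ-+ (+ 1) (+ length ys)) ⟨
  (y ℚ.* y ℚ.+ Q) ℚ.- (a ℚ.* (y ℚ.+ S) ℚ.+ a ℚ.* (y ℚ.+ S)) ℚ.+ ℤ→ℚ (+ suc (length ys)) ℚ.* (a ℚ.* a) ∎
  where
  open ≡-Reasoning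
  Q = sumℚ (map (λ y → y ℚ.* y) ys)
  S = sumℚ ys
  m = ℤ→ℚ (+ length ys)

variance : ∀ (ys : List ℚ) → length ys ≢ 0 →
  average (map (λ y → (y ℚ.- average ys) ℚ.* (y ℚ.- average ys)) ys)
  ≡ average (map (λ y → y ℚ.* y) ys) ℚ.- average ys ℚ.* average ys
variance ys len≢0 = begin
  average (map (λ y → (y ℚ.- a) ℚ.* (y ℚ.- a)) ys)
    ≡⟨ average-map (λ y → (y ℚ.- a) ℚ.* (y ℚ.- a)) ⟩
  sumℚ (map (λ y → (y ℚ.- a) ℚ.* (y ℚ.- a)) ys) ℚ.* w
    ≡⟨ cong (ℚ._* w) (sumℚ-sq-sub ys a) ⟩
  (Q ℚ.- (a ℚ.* S ℚ.+ a ℚ.* S) ℚ.+ m ℚ.* (a ℚ.* a)) ℚ.* w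
    ≡⟨ cong (λ a → (Q ℚ.- (a ℚ.* S ℚ.+ a ℚ.* S) ℚ.+ m ℚ.* (a ℚ.* a)) ℚ.* w) (÷'-by-inverse S {w} {m} w*m≡1) ⟩
  (Q ℚ.- (S ℚ.* w ℚ.* S ℚ.+ S ℚ.* w ℚ.* S) ℚ.+ m ℚ.* (S ℚ.* w ℚ.* (S ℚ.* w))) ℚ.* w
    ≡⟨ solve 4 (λ Q S m w → (Q :- (S :* w :* S :+ S :* w :* S) :+ m :* (S :* w :* (S :* w))) :* w
                         := Q :* w :- S :* w :* (S :* w) :+ S :* w :* (S :* w) :* (m :* w :- con 1ℚ))
             refl Q S m w ⟩
  Q ℚ.* w ℚ.- S ℚ.* w ℚ.* (S ℚ.* w) ℚ.+ S ℚ.* w ℚ.* (S ℚ.* w) ℚ.* (m ℚ.* w ℚ.- 1ℚ)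
    ≡⟨ cong (λ k → Q ℚ.* w ℚ.- S ℚ.* w ℚ.* (S ℚ.* w) ℚ.+ S ℚ.* w ℚ.* (S ℚ.* w) ℚ.* (k ℚ.- 1ℚ))
            (trans (ℚ.*-comm m w) w*m≡1) ⟩
  Q ℚ.* w ℚ.- S ℚ.* w ℚ.* (S ℚ.* w) ℚ.+ S ℚ.* w ℚ.* (S ℚ.* w) ℚ.* (1ℚ ℚ.- 1ℚ)
    ≡⟨ solve 2 (λ X Y → X :- Y :+ Y :* (con 1ℚ :- con 1ℚ) := X :- Y) refl (Q ℚ.* w) (S ℚ.* w ℚ.* (S ℚ.* w)) ⟩
  Q ℚ.* w ℚ.- S ℚ.* w ℚ.* (S ℚ.* w)
    ≡⟨ cong₂ (λ q a → q ℚ.- a ℚ.* a) (average-map (λ y → y ℚ.* y)) (÷'-by-inverse S {w} {m} w*m≡1) ⟨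
  average (map (λ y → y ℚ.* y) ys) ℚ.- a ℚ.* a ∎
  where
  open ≡-Reasoning
  m = ℤ→ℚ (+ length ys)
  instance
    m-nonZero : ℚ.NonZero m
    m-nonZero = ℚ.≢-nonZero (ℤ→ℚ-≢0 (len≢0 ∘ ℤ.+-injective))
  w = ℚ.1/ m
  w*m≡1 : w ℚ.* m ≡ 1ℚ
  w*m≡1 = ℚ.*-inverseˡ m
  S = sumℚ ys
  Q = sumℚ (map (λ y → y ℚ.* y) ys)
  a = average ys
  average-map : ∀ h → average (map h ys) ≡ sumℚ (map h ys) ℚ.* w
  average-map h = trans (cong (λ k → sumℚ (map h ys) ÷' ℤ→ℚ (+ k)) (List.length-map h ys))
                        (÷'-by-inverse (sumℚ (map h ys)) {w} {m} w*m≡1)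

-- The vertices of 𝒱

module _ {n : ℕ} where

  private
    branch : (Fin n → Bool) → List (Fin (suc n) → Bool)
    branch s = (true VF.∷ s) ∷ (false VF.∷ s) ∷ []

  length-branches : (ss : List (Fin n → Bool)) → length (concatMap branch ss) ≡ 2 ℕ.* length ss
  length-branches []       = refl
  length-branches (s ∷ ss) = trans (cong (ℕ.suc ∘ ℕ.suc) (length-branches ss)) (sym (ℕ.*-distribˡ-+ 2 1 (length ss)))

  sumℚ-branches : ∀ (h : (Fin (suc n) → Bool) → ℚ) ss →
    sumℚ (map h (concatMap branch ss)) ≡ sumℚ (map (λ s → h (true VF.∷ s) ℚ.+ h (false VF.∷ s)) ss)
  sumℚ-branches h []       = refl
  sumℚ-branches h (s ∷ ss) = trans (cong (λ r → h (true VF.∷ s) ℚ.+ (h (false VF.∷ s) ℚ.+ r)) (sumℚ-branches h ss))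
                                   (sym (ℚ.+-assoc (h (true VF.∷ s)) (h (false VF.∷ s)) _))

length-allSigns : ∀ n → length (allSigns n) ≡ 2 ^ n
length-allSigns zero    = refl
length-allSigns (suc n) = trans (length-branches (allSigns n)) (cong (2 ℕ.*_) (length-allSigns n))

sumℚ-allSigns : ∀ n (g : (Fin n → Bool) → ℤ) c →
  sumℚ (map (λ s → ℤ→ℚ (g s) ℚ.* c) (allSigns n)) ≡ ℤ→ℚ (∑± n g) ℚ.* c
sumℚ-allSigns zero    g c = ℚ.+-identityʳ _
sumℚ-allSigns (suc n) g c = begin
  sumℚ (map (λ s → ℤ→ℚ (g s) ℚ.* c) (allSigns (suc n)))
    ≡⟨ sumℚ-branches (λ s → ℤ→ℚ (g s) ℚ.* c) (allSigns n) ⟩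
  sumℚ (map (λ s → ℤ→ℚ (g (true VF.∷ s)) ℚ.* c ℚ.+ ℤ→ℚ (g (false VF.∷ s)) ℚ.* c) (allSigns n))
    ≡⟨ cong sumℚ (List.map-cong (λ s → collect (g (true VF.∷ s)) (g (false VF.∷ s))) (allSigns n)) ⟩
  sumℚ (map (λ s → ℤ→ℚ (g (true VF.∷ s) + g (false VF.∷ s)) ℚ.* c) (allSigns n))
    ≡⟨ sumℚ-allSigns n (λ s → g (true VF.∷ s) + g (false VF.∷ s)) c ⟩
  ℤ→ℚ (∑± (suc n) g) ℚ.* c ∎
  where
  open ≡-Reasoning
  collect : ∀ a b → ℤ→ℚ a ℚ.* c ℚ.+ ℤ→ℚ b ℚ.* c ≡ ℤ→ℚ (a + b) ℚ.* c
  collect a b = trans (sym (ℚ.*-distribʳ-+ c (ℤ→ℚ a) (ℤ→ℚ b))) (cong (ℚ._* c) (sym (ℤ→ℚ-+ a b)))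

-- 𝒱 p N unfolds to map (vertex N) (allSigns (p ∸ 1)).
vertex : ∀ {n} → ℕ → (Fin n → Bool) → Fin n → ℤ
vertex N s i = if s i then + N else - + N

module _ {n} (N : ℕ) (s : Fin n → Bool) (α : Fin n → ℤ) where

  ∑-vertex-sub : ∑ℤ n (λ i → vertex N s i - α i) ≡ + N * signSum s - ∑ℤ n α
  ∑-vertex-sub = begin
    ∑ℤ n (λ i → vertex N s i - α i)                ≡⟨ ∑ℤ-cong n (λ i → pointwise (s i) (α i)) ⟩
    ∑ℤ n (λ i → + N * (sign (s i) * + 1) - α i)    ≡⟨ ∑ℤ-distrib-- n _ α ⟩
    ∑ℤ n (λ i → + N * (sign (s i) * + 1)) - ∑ℤ n α ≡⟨ cong (_- ∑ℤ n α) (∑ℤ-distribˡ-* n (+ N) _) ⟩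
    + N * signSum s - ∑ℤ n α                       ∎
    where
    open ≡-Reasoning
    pointwise : ∀ b a → (if b then + N else - + N) - a ≡ + N * (sign b * + 1) - a
    pointwise true  = plus (+ N)
      where
      plus : ∀ x a → x - a ≡ x * (+ 1 * + 1) - a
      plus = solve-∀
    pointwise false = minus (+ N)
      where
      minus : ∀ x a → - x - a ≡ x * (- + 1 * + 1) - a
      minus = solve-∀

  ∑-vertex-sub² : ∑ℤ n (λ i → (vertex N s i - α i) * (vertex N s i - α i))
                  ≡ + n * (+ N * + N) - + 2 * + N * rademacher α s + ∑ℤ n (λ i → α i * α i)
  ∑-vertex-sub² = begin
    ∑ℤ n (λ i → (vertex N s i - α i) * (vertex N s i - α i))
      ≡⟨ ∑ℤ-cong n (λ i → pointwise (s i) (α i)) ⟩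
    ∑ℤ n (λ i → + N * + N + (- (+ 2 * + N) * (sign (s i) * α i) + α i * α i))
      ≡⟨ ∑ℤ-distrib-+ n _ _ ⟩
    ∑ℤ n (λ _ → + N * + N) + ∑ℤ n (λ i → - (+ 2 * + N) * (sign (s i) * α i) + α i * α i)
      ≡⟨ cong₂ _+_ (∑ℤ-const n (+ N * + N)) (∑ℤ-distrib-+ n _ _) ⟩
    + n * (+ N * + N) + (∑ℤ n (λ i → - (+ 2 * + N) * (sign (s i) * α i)) + Σα²)
      ≡⟨ cong (λ x → + n * (+ N * + N) + (x + Σα²)) (∑ℤ-distribˡ-* n (- (+ 2 * + N)) _) ⟩
    + n * (+ N * + N) + (- (+ 2 * + N) * rademacher α s + Σα²)
      ≡⟨ regroup (+ n * (+ N * + N)) (+ 2 * + N) (rademacher α s) Σα² ⟩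
    + n * (+ N * + N) - + 2 * + N * rademacher α s + Σα² ∎
    where
    open ≡-Reasoning
    Σα² = ∑ℤ n (λ i → α i * α i)
    pointwise : ∀ b a → ((if b then + N else - + N) - a) * ((if b then + N else - + N) - a)
                        ≡ + N * + N + (- (+ 2 * + N) * (sign b * a) + a * a)
    pointwise true  = plus (+ N)
      where
      plus : ∀ x a → (x - a) * (x - a) ≡ x * x + (- (+ 2 * x) * (+ 1 * a) + a * a)
      plus = solve-∀
    pointwise false = minus (+ N)
      where
      minus : ∀ x a → (- x - a) * (- x - a) ≡ x * x + (- (+ 2 * x) * (- + 1 * a) + a * a)
      minus = solve-∀
    regroup : ∀ q c L e → q + (- c * L + e) ≡ q - c * L + e
    regroup = solve-∀

-- The polynomial in the statement, with n² = N², t² = Tr(α)², e² = ‖α‖_E².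
rhsPolynomial : ℕ → ℤ → ℤ → ℤ → ℤ
rhsPolynomial p n² t² e² =
  (n² + + 2 * e²) * (P * P * P * P) - (n² + + 2 * t²) * (P * P * P) - (+ 3 * n² + + 2 * t²) * (P * P)
  + (n² - + 2 * t²) * P + + 2 * (n² - t²)
  where
  P = + p

module Vertices {n} (p-prime : Prime (suc n)) (N : ℕ) (α : Zω (suc n)) where

  P T E K : ℤ
  P = + suc n
  T = ∑ℤ n α
  E = ∑ℤ n (λ i → α i * α i)
  K = + (2 ^ n)

  distance² : (Fin n → Bool) → ℤ
  distance² s = normSq (suc n) (subω (suc n) (vertex N s) α)

  ∑d ∑d² coeff poly : ℤ
  ∑d = ∑± n distance²
  ∑d² = ∑± n (λ s → distance² s * distance² s)
  coeff = + (2 ℕ.* N ℕ.* N)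
  poly = rhsPolynomial (suc n) (+ (N ℕ.* N)) (Tr (suc n) α * Tr (suc n) α) E

  distance²-quadratic : ∀ s → distance² s ≡ quadratic (- (+ 2 * + N * (P * P))) (+ 2 * (P + + 1) * + N * T)
                                                       (- ((P + + 1) * (+ N * + N)))
                                                       (P * P * (+ n * (+ N * + N) + E) - (P + + 1) * (T * T)) α s
  distance²-quadratic s = begin
    distance² s
      ≡⟨ normSq≡ p-prime (subω (suc n) (vertex N s) α) ⟩
    P * P * ∑ℤ n (λ i → (vertex N s i - α i) * (vertex N s i - α i))
      - (P + + 1) * (∑ℤ n (λ i → vertex N s i - α i) * ∑ℤ n (λ i → vertex N s i - α i))
      ≡⟨ cong₂ (λ x y → P * P * x - (P + + 1) * (y * y)) (∑-vertex-sub² N s α) (∑-vertex-sub N s α) ⟩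
    P * P * (+ n * (+ N * + N) - + 2 * + N * rademacher α s + E) - (P + + 1) * ((+ N * signSum s - T) * (+ N * signSum s - T))
      ≡⟨ expand P (+ n) (+ N) T E (rademacher α s) (signSum s) ⟩
    quadratic (- (+ 2 * + N * (P * P))) (+ 2 * (P + + 1) * + N * T) (- ((P + + 1) * (+ N * + N)))
              (P * P * (+ n * (+ N * + N) + E) - (P + + 1) * (T * T)) α s ∎
    where
    open ≡-Reasoning
    expand : ∀ P m x T E L σ →
      P * P * (m * (x * x) - + 2 * x * L + E) - (P + + 1) * ((x * σ - T) * (x * σ - T))
      ≡ - (+ 2 * x * (P * P)) * L + + 2 * (P + + 1) * x * T * σ + - ((P + + 1) * (x * x)) * (σ * σ)
        + (P * P * (m * (x * x) + E) - (P + + 1) * (T * T))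
    expand = solve-∀

  spread : K * ∑d² ≡ ∑d * ∑d + K * K * (coeff * poly)
  spread = begin
    K * ∑d²
      ≡⟨ cong (K *_) (∑±-cong n (λ s → cong (λ d → d * d) (distance²-quadratic s))) ⟩
    K * ∑± n (λ s → F s * F s)
      ≡⟨ ∑±-quadratic-spread n B C G A₀ α ⟩
    ∑± n F * ∑± n F + K * K * (B * B * E + + 2 * B * C * T + C * C * + n + + 2 * G * G * (+ n * + n - + n))
      ≡⟨ cong₂ (λ x y → x * x + K * K * y) (sym (∑±-cong n distance²-quadratic)) (coefficients (+ n) (+ N) T E) ⟩
    ∑d * ∑d + K * K * (+ 2 * + N * + N * rhsPolynomial (suc n) (+ N * + N) (- T * - T) E)
      ≡⟨ cong₂ (λ c n² → ∑d * ∑d + K * K * (c * rhsPolynomial (suc n) n² (- T * - T) E))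
               (trans (ℤ.pos-* (2 ℕ.* N) N) (cong (_* + N) (ℤ.pos-* 2 N))) (ℤ.pos-* N N) ⟨
    ∑d * ∑d + K * K * (coeff * rhsPolynomial (suc n) (+ (N ℕ.* N)) (- T * - T) E)
      ≡⟨ cong (λ t → ∑d * ∑d + K * K * (coeff * rhsPolynomial (suc n) (+ (N ℕ.* N)) (t * t) E)) (Tr≡-∑ℤ p-prime α) ⟨
    ∑d * ∑d + K * K * (coeff * poly) ∎
    where
    open ≡-Reasoning
    B = - (+ 2 * + N * (P * P))
    C = + 2 * (P + + 1) * + N * T
    G = - ((P + + 1) * (+ N * + N))
    A₀ = P * P * (+ n * (+ N * + N) + E) - (P + + 1) * (T * T)
    F = quadratic B C G A₀ α
    coefficients : ∀ m x T E →
      let P = + 1 + m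
          B = - (+ 2 * x * (P * P))
          C = + 2 * (P + + 1) * x * T
          G = - ((P + + 1) * (x * x))
      in B * B * E + + 2 * B * C * T + C * C * m + + 2 * G * G * (m * m - m)
         ≡ + 2 * x * x * ((x * x + + 2 * E) * (P * P * P * P) - (x * x + + 2 * (- T * - T)) * (P * P * P)
                          - (+ 3 * (x * x) + + 2 * (- T * - T)) * (P * P) + (x * x - + 2 * (- T * - T)) * P
                          + + 2 * (x * x - - T * - T))
    coefficients = solve-∀

  spreadℚ : ℤ→ℚ K ℚ.* ℤ→ℚ ∑d² ≡ ℤ→ℚ ∑d ℚ.* ℤ→ℚ ∑d ℚ.+ ℤ→ℚ K ℚ.* ℤ→ℚ K ℚ.* (ℤ→ℚ coeff ℚ.* ℤ→ℚ poly)
  spreadℚ = begin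
    ℤ→ℚ K ℚ.* ℤ→ℚ ∑d²                          ≡⟨ ℤ→ℚ-* K ∑d² ⟨
    ℤ→ℚ (K * ∑d²)                              ≡⟨ cong ℤ→ℚ spread ⟩
    ℤ→ℚ (∑d * ∑d + K * K * (coeff * poly))     ≡⟨ ℤ→ℚ-+ (∑d * ∑d) (K * K * (coeff * poly)) ⟩
    ℤ→ℚ (∑d * ∑d) ℚ.+ ℤ→ℚ (K * K * (coeff * poly))
      ≡⟨ cong₂ ℚ._+_ (ℤ→ℚ-* ∑d ∑d) (trans (ℤ→ℚ-* (K * K) (coeff * poly)) (cong₂ ℚ._*_ (ℤ→ℚ-* K K) (ℤ→ℚ-* coeff poly))) ⟩
    ℤ→ℚ ∑d ℚ.* ℤ→ℚ ∑d ℚ.+ ℤ→ℚ K ℚ.* ℤ→ℚ K ℚ.* (ℤ→ℚ coeff ℚ.* ℤ→ℚ poly) ∎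
    where open ≡-Reasoning

  private
    2^n≢0 : 2 ^ n ≢ 0
    2^n≢0 = ℕ.≢-nonZero⁻¹ (2 ^ n) {{ℕ.m^n≢0 2 n}}
    instance
      K-nonZero : ℚ.NonZero (ℤ→ℚ K)
      K-nonZero = ℚ.≢-nonZero (ℤ→ℚ-≢0 (2^n≢0 ∘ ℤ.+-injective))
    w : ℚ
    w = ℚ.1/ ℤ→ℚ K

  length-map-𝒱 : ∀ {B : Set} (h : Zω (suc n) → B) → length (map h (𝒱 (suc n) N)) ≡ 2 ^ n
  length-map-𝒱 h = trans (List.length-map h (𝒱 (suc n) N))
                         (trans (List.length-map (vertex N) (allSigns n)) (length-allSigns n))

  average-𝒱 : ∀ (h : Zω (suc n) → ℚ) (g : (Fin n → Bool) → ℤ) c → (∀ s → h (vertex N s) ≡ ℤ→ℚ (g s) ℚ.* c) →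
              average (map h (𝒱 (suc n) N)) ≡ ℤ→ℚ (∑± n g) ℚ.* c ℚ.* w
  average-𝒱 h g c h≡ = begin
    sumℚ (map h (map (vertex N) l)) ÷' ℤ→ℚ (+ length (map h (map (vertex N) l)))
      ≡⟨ cong (λ k → sumℚ (map h (map (vertex N) l)) ÷' ℤ→ℚ (+ k)) (length-map-𝒱 h) ⟩
    sumℚ (map h (map (vertex N) l)) ÷' ℤ→ℚ K
      ≡⟨ ÷'-by-inverse (sumℚ (map h (map (vertex N) l))) {w} {ℤ→ℚ K} (ℚ.*-inverseˡ (ℤ→ℚ K)) ⟩
    sumℚ (map h (map (vertex N) l)) ℚ.* w
      ≡⟨ cong (λ xs → sumℚ xs ℚ.* w) (List.map-∘ l) ⟨
    sumℚ (map (h ∘ vertex N) l) ℚ.* w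
      ≡⟨ cong (λ xs → sumℚ xs ℚ.* w) (List.map-cong h≡ l) ⟩
    sumℚ (map (λ s → ℤ→ℚ (g s) ℚ.* c) l) ℚ.* w
      ≡⟨ cong (ℚ._* w) (sumℚ-allSigns n g c) ⟩
    ℤ→ℚ (∑± n g) ℚ.* c ℚ.* w ∎
    where
    open ≡-Reasoning
    l = allSigns n

  module _ (D²≢0 : Dsq (suc n) N ≢ 0ℚ) where

    private
      D² = Dsq (suc n) N
      instance
        D²-nonZero : ℚ.NonZero D²
        D²-nonZero = ℚ.≢-nonZero D²≢0
      u = ℚ.1/ D²
      d = 𝔡sq (suc n) N α
      uu*DD≡1 : u ℚ.* u ℚ.* (D² ℚ.* D²) ≡ 1ℚ
      uu*DD≡1 = begin
        u ℚ.* u ℚ.* (D² ℚ.* D²)  ≡⟨ solve 2 (λ u D → u :* u :* (D :* D) := u :* D :* (u :* D)) refl u D² ⟩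
        u ℚ.* D² ℚ.* (u ℚ.* D²)  ≡⟨ cong (λ x → x ℚ.* x) (ℚ.*-inverseˡ D²) ⟩
        1ℚ                       ∎
        where open ≡-Reasoning

    M≡moments : M (suc n) N α ≡ ℤ→ℚ ∑d² ℚ.* (u ℚ.* u) ℚ.* w ℚ.- ℤ→ℚ ∑d ℚ.* u ℚ.* w ℚ.* (ℤ→ℚ ∑d ℚ.* u ℚ.* w)
    M≡moments = begin
      M (suc n) N α
        ≡⟨ cong average (List.map-∘ (𝒱 (suc n) N)) ⟩
      average (map (λ y → (y ℚ.- A′) ℚ.* (y ℚ.- A′)) (map d (𝒱 (suc n) N)))
        ≡⟨ variance (map d (𝒱 (suc n) N)) (2^n≢0 ∘ trans (sym (length-map-𝒱 d))) ⟩
      average (map (λ y → y ℚ.* y) (map d (𝒱 (suc n) N))) ℚ.- A′ ℚ.* A′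
        ≡⟨ cong (λ xs → average xs ℚ.- A′ ℚ.* A′) (List.map-∘ (𝒱 (suc n) N)) ⟨
      average (map (λ x → d x ℚ.* d x) (𝒱 (suc n) N)) ℚ.- A′ ℚ.* A′
        ≡⟨ cong₂ (λ x y → x ℚ.- y ℚ.* y)
                 (average-𝒱 (λ x → d x ℚ.* d x) (λ s → distance² s * distance² s) (u ℚ.* u) d²-vertex)
                 (average-𝒱 d distance² u d-vertex) ⟩
      ℤ→ℚ ∑d² ℚ.* (u ℚ.* u) ℚ.* w ℚ.- ℤ→ℚ ∑d ℚ.* u ℚ.* w ℚ.* (ℤ→ℚ ∑d ℚ.* u ℚ.* w) ∎
      where
      open ≡-Reasoning
      A′ = A (suc n) N α
      d-vertex : ∀ s → d (vertex N s) ≡ ℤ→ℚ (distance² s) ℚ.* u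
      d-vertex s = ÷'-by-inverse (ℤ→ℚ (distance² s)) {u} {D²} (ℚ.*-inverseˡ D²)
      d²-vertex : ∀ s → d (vertex N s) ℚ.* d (vertex N s) ≡ ℤ→ℚ (distance² s * distance² s) ℚ.* (u ℚ.* u)
      d²-vertex s = begin
        d (vertex N s) ℚ.* d (vertex N s)
          ≡⟨ cong (λ x → x ℚ.* x) (d-vertex s) ⟩
        ℤ→ℚ (distance² s) ℚ.* u ℚ.* (ℤ→ℚ (distance² s) ℚ.* u)
          ≡⟨ solve 2 (λ a u → (a :* u) :* (a :* u) := (a :* a) :* (u :* u)) refl (ℤ→ℚ (distance² s)) u ⟩
        ℤ→ℚ (distance² s) ℚ.* ℤ→ℚ (distance² s) ℚ.* (u ℚ.* u)
          ≡⟨ cong (ℚ._* (u ℚ.* u)) (ℤ→ℚ-* (distance² s) (distance² s)) ⟨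
        ℤ→ℚ (distance² s * distance² s) ℚ.* (u ℚ.* u) ∎

    M≡RHS : M (suc n) N α ≡ RHS (suc n) N α
    M≡RHS = begin
      M (suc n) N α
        ≡⟨ M≡moments ⟩
      S₂ ℚ.* (u ℚ.* u) ℚ.* w ℚ.- S₁ ℚ.* u ℚ.* w ℚ.* (S₁ ℚ.* u ℚ.* w)
        ≡⟨ solve 5 (λ S₁ S₂ K u w → S₂ :* (u :* u) :* w :- S₁ :* u :* w :* (S₁ :* u :* w)
                                  := u :* u :* (w :* w) :* (K :* S₂) :- u :* u :* (w :* w) :* (S₁ :* S₁)
                                     :+ S₂ :* (u :* u) :* w :* (con 1ℚ :- K :* w))
                 refl S₁ S₂ K′ u w ⟩
      u ℚ.* u ℚ.* (w ℚ.* w) ℚ.* (K′ ℚ.* S₂) ℚ.- u ℚ.* u ℚ.* (w ℚ.* w) ℚ.* (S₁ ℚ.* S₁)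
        ℚ.+ S₂ ℚ.* (u ℚ.* u) ℚ.* w ℚ.* (1ℚ ℚ.- K′ ℚ.* w)
        ≡⟨ cong₂ (λ x y → u ℚ.* u ℚ.* (w ℚ.* w) ℚ.* x ℚ.- u ℚ.* u ℚ.* (w ℚ.* w) ℚ.* (S₁ ℚ.* S₁)
                          ℚ.+ S₂ ℚ.* (u ℚ.* u) ℚ.* w ℚ.* (1ℚ ℚ.- y))
                 spreadℚ (ℚ.*-inverseʳ K′) ⟩
      u ℚ.* u ℚ.* (w ℚ.* w) ℚ.* (S₁ ℚ.* S₁ ℚ.+ K′ ℚ.* K′ ℚ.* (c ℚ.* p)) ℚ.- u ℚ.* u ℚ.* (w ℚ.* w) ℚ.* (S₁ ℚ.* S₁)
        ℚ.+ S₂ ℚ.* (u ℚ.* u) ℚ.* w ℚ.* (1ℚ ℚ.- 1ℚ)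
        ≡⟨ solve 7 (λ S₁ S₂ K u w c p → u :* u :* (w :* w) :* (S₁ :* S₁ :+ K :* K :* (c :* p))
                                        :- u :* u :* (w :* w) :* (S₁ :* S₁) :+ S₂ :* (u :* u) :* w :* (con 1ℚ :- con 1ℚ)
                                      := c :* (u :* u) :* p :* (K :* w :* (K :* w)))
                 refl S₁ S₂ K′ u w c p ⟩
      c ℚ.* (u ℚ.* u) ℚ.* p ℚ.* (K′ ℚ.* w ℚ.* (K′ ℚ.* w))
        ≡⟨ cong (λ x → c ℚ.* (u ℚ.* u) ℚ.* p ℚ.* (x ℚ.* x)) (ℚ.*-inverseʳ K′) ⟩
      c ℚ.* (u ℚ.* u) ℚ.* p ℚ.* (1ℚ ℚ.* 1ℚ)
        ≡⟨ solve 1 (λ x → x :* (con 1ℚ :* con 1ℚ) := x) refl (c ℚ.* (u ℚ.* u) ℚ.* p) ⟩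
      c ℚ.* (u ℚ.* u) ℚ.* p
        ≡⟨ cong (ℚ._* p) (÷'-by-inverse c {u ℚ.* u} {D² ℚ.* D²} uu*DD≡1) ⟨
      RHS (suc n) N α ∎
      where
      open ≡-Reasoning
      S₁ = ℤ→ℚ ∑d
      S₂ = ℤ→ℚ ∑d²
      K′ = ℤ→ℚ K
      c = ℤ→ℚ coeff
      p = ℤ→ℚ poly

lemma4 : (p N : ℕ) → Prime p → p ≢ 2 → 1 ≤ N →
    (α : Zω p) → M p N α ≡ RHS p N α
lemma4 0                 N         p-prime _ _         α = contradiction p-prime ¬prime[0]
lemma4 1                 N         p-prime _ _         α = contradiction p-prime ¬prime[1]
lemma4 p@(suc n@(suc _)) N@(suc _) p-prime _ (s≤s _)   α =
  Vertices.M≡RHS p-prime N α (ℤ→ℚ-≢0 {+ (4 ℕ.* N ℕ.* N ℕ.* p ℕ.* p ℕ.* n)} λ ())
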